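{- Let $\alpha, t$ be rational numbers with $(2\alpha+3)t^2 + 1 \neq 0$, and set $$a = \frac{\alpha^2 + t^2}{(2\alpha+3)t^2 + 1},\quad p = t(at^2+1),\quad q = at^2 - \alpha,\quad r = t(at^2-\alpha),\quad s = t^2+1 .$$ Then $pq(p^2+q^2) = a\,rs(r^2+s^2)$; equivalently, $A=p+q$, $B=r-s$, $C=p-q$, $D=r+s$ satisfy $A^4 + aB^4 = C^4 + aD^4$. -}

module Defs where

open import Data.Rational using (ℚ; 0ℚ; 1ℚ; _+_; _*_; _-_; _÷_; ≢-nonZero)
open import Data.Nat using (ℕ)
open import Relation.Binary.PropositionalEquality using (_≢_)

sq : ℚ → ℚ
sq x = x * x

pow4 : ℚ → ℚ
pow4 x = sq (sq x)

2ℚ 3ℚ : ℚ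
2ℚ = 1ℚ + 1ℚ
3ℚ = 2ℚ + 1ℚ

den : ℚ → ℚ → ℚ
den α t = (2ℚ * α + 3ℚ) * sq t + 1ℚ

aOf : (α t : ℚ) → den α t ≢ 0ℚ → ℚ
aOf α t h = _÷_ (sq α + sq t) (den α t) {{≢-nonZero h}}

pOf qOf rOf sOf : (a α t : ℚ) → ℚ
pOf a α t = t * (a * sq t + 1ℚ)
qOf a α t = a * sq t - α
rOf a α t = t * (a * sq t - α)
sOf a α t = sq t + 1ℚ

-- The theorem is a polynomial identity in disguise.  Write
--   P(p,q) = p q (p² + q²)   and   R(a,r,s) = a r s (r² + s²).
-- (1) For arbitrary a, p, q, r, s the quartic difference
--       (p+q)⁴ + a(r-s)⁴ - (p-q)⁴ - a(r+s)⁴  equals  8 (P - R),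
--     so the quartic relation follows from the product relation P = R.
-- (2) For arbitrary a, α, t and the parametrised p, q, r, s we have
--       P - R = g · (a · ((2α+3)t² + 1) - (α² + t²)),
--     with the explicit cofactor g = a²t⁷ - aαt⁵ - at³ + αt.
-- (3) The defining equation of a says exactly that the second factor in
--     (2) vanishes, hence P = R, and by (1) the quartic relation holds.
module Submission where

open import Defs
open import Data.Rational using (ℚ; 0ℚ; 1ℚ; _+_; _*_; _-_; 1/_; ≢-nonZero)
open import Data.Rational.Properties
  using (*-assoc; *-inverseˡ; *-identityʳ; *-zeroʳ; +-identityʳ; +-inverseʳ)
open import Data.Rational.Solver using (module +-*-Solver)
open import Data.Product using (_×_; _,_)
open import Relation.Binary.PropositionalEquality
  using (_≡_; _≢_; refl; cong; trans; module ≡-Reasoning)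
open +-*-Solver

productSide : ℚ → ℚ → ℚ
productSide p q = p * q * (sq p + sq q)

weightedProductSide : ℚ → ℚ → ℚ → ℚ
weightedProductSide a r s = a * r * s * (sq r + sq s)

8ℚ : ℚ
8ℚ = 3ℚ + 3ℚ + 2ℚ

dropVanishing : ∀ x y {z w} → z ≡ w → x + y * (z - w) ≡ x
dropVanishing x y {z} refl = begin
  x + y * (z - z) ≡⟨ cong (λ d → x + y * d) (+-inverseʳ z) ⟩
  x + y * 0ℚ      ≡⟨ cong (x +_) (*-zeroʳ y) ⟩
  x + 0ℚ          ≡⟨ +-identityʳ x ⟩
  x               ∎
  where open ≡-Reasoning

quarticDifference : ∀ a p q r s →
  pow4 (p + q) + a * pow4 (r - s)
    ≡ pow4 (p - q) + a * pow4 (r + s)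
      + 8ℚ * (productSide p q - weightedProductSide a r s)
quarticDifference = solve 5 (λ a p q r s →
  let sq′ = λ x → x :* x
      pow4′ = λ x → sq′ (sq′ x)
  in pow4′ (p :+ q) :+ a :* pow4′ (r :- s)
     := pow4′ (p :- q) :+ a :* pow4′ (r :+ s)
        :+ con 8ℚ :* (p :* q :* (sq′ p :+ sq′ q) :- a :* r :* s :* (sq′ r :+ sq′ s)))
  refl

quarticFromProduct : ∀ a p q r s →
  productSide p q ≡ weightedProductSide a r s →
  pow4 (p + q) + a * pow4 (r - s) ≡ pow4 (p - q) + a * pow4 (r + s)
quarticFromProduct a p q r s e =
  trans (quarticDifference a p q r s) (dropVanishing _ 8ℚ e)

cofactor : ℚ → ℚ → ℚ → ℚ
cofactor a α t = a * a * (t * t * t * t * t * t * t) - a * α * (t * t * t * t * t)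
                 - a * (t * t * t) + α * t

productDifference : ∀ a α t →
  productSide (pOf a α t) (qOf a α t)
    ≡ weightedProductSide a (rOf a α t) (sOf a α t)
      + cofactor a α t * (a * den α t - (sq α + sq t))
productDifference = solve 3 (λ a α t →
  let sq′ = λ x → x :* x
      p = t :* (a :* sq′ t :+ con 1ℚ)
      q = a :* sq′ t :- α
      r = t :* (a :* sq′ t :- α)
      s = sq′ t :+ con 1ℚ
  in p :* q :* (sq′ p :+ sq′ q)
     := a :* r :* s :* (sq′ r :+ sq′ s)
        :+ (a :* a :* (t :* t :* t :* t :* t :* t :* t) :- a :* α :* (t :* t :* t :* t :* t)
            :- a :* (t :* t :* t) :+ α :* t)
           :* (a :* ((con 2ℚ :* α :+ con 3ℚ) :* sq′ t :+ con 1ℚ) :- (sq′ α :+ sq′ t)))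
  refl

aOf-defining : ∀ α t (h : den α t ≢ 0ℚ) → aOf α t h * den α t ≡ sq α + sq t
aOf-defining α t h = begin
  (sq α + sq t) * 1/d * d   ≡⟨ *-assoc (sq α + sq t) 1/d d ⟩
  (sq α + sq t) * (1/d * d) ≡⟨ cong ((sq α + sq t) *_) (*-inverseˡ d {{≢-nonZero h}}) ⟩
  (sq α + sq t) * 1ℚ        ≡⟨ *-identityʳ (sq α + sq t) ⟩
  sq α + sq t               ∎
  where
  open ≡-Reasoning
  d 1/d : ℚ
  d = den α t
  1/d = 1/_ d {{≢-nonZero h}}

mainTheorem5 : (α t : ℚ) → (h : den α t ≢ 0ℚ) →
    let a = aOf α t h
        p = pOf a α t
        q = qOf a α t
        r = rOf a α t
        s = sOf a α t
    in (p * q * (sq p + sq q) ≡ a * r * s * (sq r + sq s))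
       × (pow4 (p + q) + a * pow4 (r - s) ≡ pow4 (p - q) + a * pow4 (r + s))
mainTheorem5 α t h = productRelation , quarticFromProduct a p q r s productRelation
  where
  a p q r s : ℚ
  a = aOf α t h
  p = pOf a α t
  q = qOf a α t
  r = rOf a α t
  s = sOf a α t

  productRelation : productSide p q ≡ weightedProductSide a r s
  productRelation = trans (productDifference a α t)
                          (dropVanishing _ (cofactor a α t) (aOf-defining α t h))
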